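{- Let $a_0,\dots,a_{15}\in\mathbb{Z}$ and let $N_4,N_8,N_{16}$ be as in the context. Then $N_4N_8N_{16}\in \mathbb{Z}_{\rm odd}\cup 16\mathbb{Z}$.
   Context: Let $f(x)=\sum_{k=0}^{15}a_kx^k$ and $\zeta_{16}=e^{2\pi\sqrt{ -1}/16}$. For each divisor $d$ of $16$, $N_d := \prod_{0\le l\le 15,\ \gcd(l,16)=d} f(\zeta_{16}^l)$ (with $\gcd(0,16)=16$); each $N_d$ is an integer. $\mathbb{Z}_{\rm odd}$ is the set of odd integers. -}

module Defs where

open import Data.Nat as ℕ using (ℕ; zero; suc)
open import Data.Nat.GCD using (gcd)
open import Data.Integer as ℤ using (ℤ; +_; -_)
open import Data.Integer.Divisibility using (_∣_)
open import Data.Vec using (Vec; []; _∷_; replicate; map; zipWith)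
open import Data.List as List using (List; upTo; filter; foldr)
open import Relation.Nullary using (¬_)

-- The ring ℤ[ζ₁₆] = ℤ[x]/(x⁸ + 1), ζ₁₆ ↦ x.
-- An element is its coefficient vector (c₀,…,c₇) w.r.t. 1, ζ, …, ζ⁷.
Zζ : Set
Zζ = Vec ℤ 8

const : ℤ → Zζ
const c = c ∷ replicate 7 (+ 0)

0ζ 1ζ : Zζ
0ζ = const (+ 0)
1ζ = const (+ 1)

_⊕_ : Zζ → Zζ → Zζ
_⊕_ = zipWith ℤ._+_

scale : ℤ → Zζ → Zζ
scale c = map (c ℤ.*_)

-- multiplication by ζ (uses ζ⁸ = -1)
mulζ : Zζ → Zζ
mulζ (c0 ∷ c1 ∷ c2 ∷ c3 ∷ c4 ∷ c5 ∷ c6 ∷ c7 ∷ []) =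
  (- c7) ∷ c0 ∷ c1 ∷ c2 ∷ c3 ∷ c4 ∷ c5 ∷ c6 ∷ []

mulAux : ∀ {n} → Zζ → Vec ℤ n → Zζ
mulAux p []       = 0ζ
mulAux p (c ∷ cs) = scale c p ⊕ mulAux (mulζ p) cs

_⊗_ : Zζ → Zζ → Zζ
p ⊗ q = mulAux p q

ζpow : ℕ → Zζ
ζpow zero    = 1ζ
ζpow (suc l) = mulζ (ζpow l)

eval : ∀ {n} → Vec ℤ n → Zζ → Zζ
eval []       w = 0ζ
eval (a ∷ as) w = const a ⊕ (w ⊗ eval as w)

-- N_d = ∏_{0 ≤ l ≤ 15, gcd(l,16) = d} f(ζ₁₆^l)   (gcd 0 16 = 16)
N : Vec ℤ 16 → ℕ → Zζ
N a d = foldr (λ l acc → eval a (ζpow l) ⊗ acc) 1ζ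
          (filter (λ l → gcd l 16 ℕ.≟ d) (upTo 16))

Odd : ℤ → Set
Odd c = ¬ (+ 2 ∣ c)

-- The elements ζ⁰, ζ⁴, ζ⁸, ζ¹² are 1, i, -1, -i, so the product only involves
-- f(1), f(-1) and f(i)f(-i) = |f(i)|², all of which live in the Gaussian integers.
-- Writing E and O for the sums of the even- and odd-indexed coefficients,
-- f(±1) = E ± O and f(i) ≡ E + O i (mod 2), so the product is
-- (x² + y²)(E² − O²) with x ≡ E and y ≡ O (mod 2). If E and O have different
-- parities every factor is odd; if both are even, 4 divides both x² + y² and
-- E² − O²; if both are odd, 2 ∣ x² + y² and 8 ∣ E² − O².
module Submission where

open import Defs
open import Data.Integer using (ℤ; +_; -_; _+_; _*_; _-_; _%_; _/_; ∣_∣)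
open import Data.Integer.Divisibility using (_∣_)
import Data.Integer.Divisibility.Signed as Signed
open import Data.Integer.DivMod using (a≡a%n+[a/n]*n; n%d<d)
open import Data.Integer.Properties using (abs-*; neg-distrib-+)
open import Data.Integer.Tactic.RingSolver using (solve-∀)
open import Data.Nat using (suc; s≤s)
import Data.Nat.Divisibility as ℕ
open import Data.Nat.Primality using (euclidsLemma; prime?)
open import Data.Product using (∃; ∃₂; _×_; _,_)
open import Data.Sum using (_⊎_; inj₁; inj₂; [_,_]′)
open import Data.Vec using (Vec; []; _∷_)
open import Data.Vec.Relation.Binary.Pointwise.Inductive using (Pointwise-≡⇒≡; []; _∷_)
open import Relation.Binary.PropositionalEquality
  using (_≡_; refl; sym; trans; cong; cong₂; subst; module ≡-Reasoning)
open import Relation.Nullary using (¬_)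
open import Relation.Nullary.Decidable using (from-yes)

open ≡-Reasoning

ℤ[i] : Set
ℤ[i] = ℤ × ℤ

real : ℤ → ℤ[i]
real a = a , + 0

1ᵢ -1ᵢ i : ℤ[i]
1ᵢ  = real (+ 1)
-1ᵢ = real (- + 1)
i   = + 0 , + 1

infixl 6 _+ᵢ_
infixl 7 _*ᵢ_

_+ᵢ_ : ℤ[i] → ℤ[i] → ℤ[i]
(x , y) +ᵢ (u , v) = x + u , y + v

_*ᵢ_ : ℤ[i] → ℤ[i] → ℤ[i]
(p , q) *ᵢ (r , s) = p * r - q * s , p * s + q * r

conj : ℤ[i] → ℤ[i]
conj (x , y) = x , - y

norm : ℤ[i] → ℤ
norm (x , y) = x * x + y * y

*ᵢ-identityʳ : ∀ u → u *ᵢ 1ᵢ ≡ u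
*ᵢ-identityʳ (x , y) = cong₂ _,_ (re x y) (im x y)
  where
  re : ∀ x y → x * + 1 - y * + 0 ≡ x
  re = solve-∀
  im : ∀ x y → x * + 0 + y * + 1 ≡ y
  im = solve-∀

real-* : ∀ a b → real a *ᵢ real b ≡ real (a * b)
real-* a b = cong₂ _,_ (re a b) (im a b)
  where
  re : ∀ a b → a * b - + 0 * + 0 ≡ a * b
  re = solve-∀
  im : ∀ a b → a * + 0 + + 0 * b ≡ + 0
  im = solve-∀

*ᵢ-conj : ∀ z → z *ᵢ conj z ≡ real (norm z)
*ᵢ-conj (x , y) = cong₂ _,_ (re x y) (im x y)
  where
  re : ∀ x y → x * x - y * - y ≡ x * x + y * y
  re = solve-∀
  im : ∀ x y → x * - y + y * x ≡ + 0
  im = solve-∀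

conj-+ᵢ : ∀ u v → conj (u +ᵢ v) ≡ conj u +ᵢ conj v
conj-+ᵢ (x , y) (u , v) = cong (x + u ,_) (neg-distrib-+ y v)

conj-*ᵢ : ∀ u v → conj (u *ᵢ v) ≡ conj u *ᵢ conj v
conj-*ᵢ (p , q) (r , s) = cong₂ _,_ (re p q r s) (im p q r s)
  where
  re : ∀ p q r s → p * r - q * s ≡ p * r - - q * - s
  re = solve-∀
  im : ∀ p q r s → - (p * s + q * r) ≡ p * - s + - q * r
  im = solve-∀

ι : ℤ[i] → Zζ
ι (x , y) = x ∷ + 0 ∷ + 0 ∷ + 0 ∷ y ∷ + 0 ∷ + 0 ∷ + 0 ∷ []

-- Each coordinate of ι (p , q) ⊗ ι (r , s) is r cⱼ + s c′ⱼ interleaved with the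
-- six products by the zero coordinates of ι (r , s), which reduce to + 0.
ι-* : ∀ u v → ι u ⊗ ι v ≡ ι (u *ᵢ v)
ι-* (p , q) (r , s) = Pointwise-≡⇒≡
  (re p q r s ∷ vanish r s ∷ vanish r s ∷ vanish r s ∷
   im p q r s ∷ vanish r s ∷ vanish r s ∷ vanish r s ∷ [])
  where
  re : ∀ p q r s →
    r * p + (+ 0 + (+ 0 + (+ 0 + (s * - q + (+ 0 + (+ 0 + (+ 0 + + 0))))))) ≡ p * r - q * s
  re = solve-∀
  im : ∀ p q r s →
    r * q + (+ 0 + (+ 0 + (+ 0 + (s * p + (+ 0 + (+ 0 + (+ 0 + + 0))))))) ≡ p * s + q * r
  im = solve-∀
  vanish : ∀ r s →
    r * + 0 + (+ 0 + (+ 0 + (+ 0 + (s * + 0 + (+ 0 + (+ 0 + (+ 0 + + 0))))))) ≡ + 0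
  vanish = solve-∀

evalᵢ : ∀ {n} → Vec ℤ n → ℤ[i] → ℤ[i]
evalᵢ []       w = real (+ 0)
evalᵢ (a ∷ as) w = real a +ᵢ w *ᵢ evalᵢ as w

eval-ι : ∀ {n} (as : Vec ℤ n) w → eval as (ι w) ≡ ι (evalᵢ as w)
eval-ι []       w = refl
eval-ι (a ∷ as) w = begin
  const a ⊕ (ι w ⊗ eval as (ι w))        ≡⟨ cong (λ e → const a ⊕ (ι w ⊗ e)) (eval-ι as w) ⟩
  const a ⊕ (ι w ⊗ ι (evalᵢ as w))       ≡⟨ cong (const a ⊕_) (ι-* w (evalᵢ as w)) ⟩
  ι (real a +ᵢ w *ᵢ evalᵢ as w)          ∎

eval⊗ι : ∀ {n} (as : Vec ℤ n) w u → eval as (ι w) ⊗ ι u ≡ ι (evalᵢ as w *ᵢ u)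
eval⊗ι as w u = trans (cong (_⊗ ι u) (eval-ι as w)) (ι-* (evalᵢ as w) u)

evalᵢ-conj : ∀ {n} (as : Vec ℤ n) w → evalᵢ as (conj w) ≡ conj (evalᵢ as w)
evalᵢ-conj []       w = refl
evalᵢ-conj (a ∷ as) w = begin
  real a +ᵢ conj w *ᵢ evalᵢ as (conj w)   ≡⟨ cong (λ e → real a +ᵢ conj w *ᵢ e) (evalᵢ-conj as w) ⟩
  real a +ᵢ conj w *ᵢ conj (evalᵢ as w)   ≡⟨ cong (real a +ᵢ_) (sym (conj-*ᵢ w (evalᵢ as w))) ⟩
  real a +ᵢ conj (w *ᵢ evalᵢ as w)        ≡⟨ sym (conj-+ᵢ (real a) (w *ᵢ evalᵢ as w)) ⟩
  conj (real a +ᵢ w *ᵢ evalᵢ as w)        ∎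

evenSum oddSum : ∀ {n} → Vec ℤ n → ℤ
evenSum []       = + 0
evenSum (a ∷ as) = a + oddSum as
oddSum  []       = + 0
oddSum  (a ∷ as) = evenSum as

real-horner-step : ∀ a r b → real a +ᵢ real r *ᵢ real b ≡ real (a + r * b)
real-horner-step a r b = cong (real a +ᵢ_) (real-* r b)

evalᵢ-one : ∀ {n} (as : Vec ℤ n) → evalᵢ as 1ᵢ ≡ real (evenSum as + oddSum as)
evalᵢ-one []       = refl
evalᵢ-one (a ∷ as) = begin
  real a +ᵢ 1ᵢ *ᵢ evalᵢ as 1ᵢ                       ≡⟨ cong (λ e → real a +ᵢ 1ᵢ *ᵢ e) (evalᵢ-one as) ⟩
  real a +ᵢ 1ᵢ *ᵢ real (evenSum as + oddSum as)     ≡⟨ real-horner-step a (+ 1) _ ⟩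
  real (a + + 1 * (evenSum as + oddSum as))         ≡⟨ cong real (regroup a (evenSum as) (oddSum as)) ⟩
  real ((a + oddSum as) + evenSum as)               ∎
  where
  regroup : ∀ a e o → a + + 1 * (e + o) ≡ (a + o) + e
  regroup = solve-∀

evalᵢ-minus-one : ∀ {n} (as : Vec ℤ n) → evalᵢ as -1ᵢ ≡ real (evenSum as - oddSum as)
evalᵢ-minus-one []       = refl
evalᵢ-minus-one (a ∷ as) = begin
  real a +ᵢ -1ᵢ *ᵢ evalᵢ as -1ᵢ                     ≡⟨ cong (λ e → real a +ᵢ -1ᵢ *ᵢ e) (evalᵢ-minus-one as) ⟩
  real a +ᵢ -1ᵢ *ᵢ real (evenSum as - oddSum as)    ≡⟨ real-horner-step a (- + 1) _ ⟩
  real (a + - + 1 * (evenSum as - oddSum as))       ≡⟨ cong real (regroup a (evenSum as) (oddSum as)) ⟩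
  real ((a + oddSum as) - evenSum as)               ∎
  where
  regroup : ∀ a e o → a + - + 1 * (e - o) ≡ (a + o) - e
  regroup = solve-∀

evalᵢ-i : ∀ {n} (as : Vec ℤ n) →
  ∃₂ λ s t → evalᵢ as i ≡ (evenSum as + + 2 * s , oddSum as + + 2 * t)
evalᵢ-i []       = + 0 , + 0 , refl
evalᵢ-i (a ∷ as) with evalᵢ as i | evalᵢ-i as
... | _ | s , t , refl =
  - oddSum as - t , s , cong₂ _,_ (re a (evenSum as) (oddSum as) s t) (im (evenSum as) (oddSum as) s t)
  where
  re : ∀ a e o s t → a + (+ 0 * (e + + 2 * s) - + 1 * (o + + 2 * t)) ≡ (a + o) + + 2 * (- o - t)
  re = solve-∀
  im : ∀ e o s t → + 0 + (+ 0 * (o + + 2 * t) + + 1 * (e + + 2 * s)) ≡ e + + 2 * s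
  im = solve-∀

product-of-conjugates : ∀ z m p →
  (z *ᵢ (conj z *ᵢ 1ᵢ)) *ᵢ (real m *ᵢ 1ᵢ) *ᵢ (real p *ᵢ 1ᵢ) ≡ real (norm z * m * p)
product-of-conjugates z m p = begin
  z *ᵢ (conj z *ᵢ 1ᵢ) *ᵢ (real m *ᵢ 1ᵢ) *ᵢ (real p *ᵢ 1ᵢ)
    ≡⟨ cong₂ (λ u v → z *ᵢ u *ᵢ v *ᵢ (real p *ᵢ 1ᵢ)) (*ᵢ-identityʳ (conj z)) (*ᵢ-identityʳ (real m)) ⟩
  z *ᵢ conj z *ᵢ real m *ᵢ (real p *ᵢ 1ᵢ)
    ≡⟨ cong (z *ᵢ conj z *ᵢ real m *ᵢ_) (*ᵢ-identityʳ (real p)) ⟩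
  z *ᵢ conj z *ᵢ real m *ᵢ real p
    ≡⟨ cong (λ w → w *ᵢ real m *ᵢ real p) (*ᵢ-conj z) ⟩
  real (norm z) *ᵢ real m *ᵢ real p
    ≡⟨ cong (_*ᵢ real p) (real-* (norm z) m) ⟩
  real (norm z * m) *ᵢ real p
    ≡⟨ real-* (norm z * m) p ⟩
  real (norm z * m * p)
    ∎

-- N a 4, N a 8 and N a 16 compute to the products over l ∈ {4, 12}, {8} and {0},
-- and ζpow 4, ζpow 12, ζpow 8, ζpow 0 compute to ι i, ι (conj i), ι -1ᵢ, ι 1ᵢ.
N-product : (a : Vec ℤ 16) → (N a 4 ⊗ N a 8) ⊗ N a 16 ≡
  const (norm (evalᵢ a i) * (evenSum a - oddSum a) * (evenSum a + oddSum a))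
N-product a = begin
  (N a 4 ⊗ N a 8) ⊗ N a 16
    ≡⟨ cong₂ _⊗_ (cong₂ _⊗_ N₄ (eval⊗ι a -1ᵢ 1ᵢ)) (eval⊗ι a 1ᵢ 1ᵢ) ⟩
  (ι (f i *ᵢ (f (conj i) *ᵢ 1ᵢ)) ⊗ ι (f -1ᵢ *ᵢ 1ᵢ)) ⊗ ι (f 1ᵢ *ᵢ 1ᵢ)
    ≡⟨ cong (_⊗ ι (f 1ᵢ *ᵢ 1ᵢ)) (ι-* (f i *ᵢ (f (conj i) *ᵢ 1ᵢ)) (f -1ᵢ *ᵢ 1ᵢ)) ⟩
  ι (f i *ᵢ (f (conj i) *ᵢ 1ᵢ) *ᵢ (f -1ᵢ *ᵢ 1ᵢ)) ⊗ ι (f 1ᵢ *ᵢ 1ᵢ)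
    ≡⟨ ι-* (f i *ᵢ (f (conj i) *ᵢ 1ᵢ) *ᵢ (f -1ᵢ *ᵢ 1ᵢ)) (f 1ᵢ *ᵢ 1ᵢ) ⟩
  ι (f i *ᵢ (f (conj i) *ᵢ 1ᵢ) *ᵢ (f -1ᵢ *ᵢ 1ᵢ) *ᵢ (f 1ᵢ *ᵢ 1ᵢ))
    ≡⟨ cong ι evaluate ⟩
  const (norm (f i) * (evenSum a - oddSum a) * (evenSum a + oddSum a))
    ∎
  where
  f : ℤ[i] → ℤ[i]
  f = evalᵢ a

  N₄ : N a 4 ≡ ι (f i *ᵢ (f (conj i) *ᵢ 1ᵢ))
  N₄ = trans (cong (eval a (ι i) ⊗_) (eval⊗ι a (conj i) 1ᵢ)) (eval⊗ι a i _)

  evaluate : f i *ᵢ (f (conj i) *ᵢ 1ᵢ) *ᵢ (f -1ᵢ *ᵢ 1ᵢ) *ᵢ (f 1ᵢ *ᵢ 1ᵢ) ≡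
             real (norm (f i) * (evenSum a - oddSum a) * (evenSum a + oddSum a))
  evaluate rewrite evalᵢ-conj a i | evalᵢ-minus-one a | evalᵢ-one a =
    product-of-conjugates (evalᵢ a i) _ _

even-or-odd : ∀ u → ∃ λ k → u ≡ + 2 * k ⊎ u ≡ + 1 + + 2 * k
even-or-odd u with u % + 2 | n%d<d u (+ 2) | a≡a%n+[a/n]*n u (+ 2)
... | 0           | _             | u≡ = u / + 2 , inj₁ (trans u≡ (even (u / + 2)))
  where
  even : ∀ k → + 0 + k * + 2 ≡ + 2 * k
  even = solve-∀
... | 1           | _             | u≡ = u / + 2 , inj₂ (trans u≡ (odd (u / + 2)))
  where
  odd : ∀ k → + 1 + k * + 2 ≡ + 1 + + 2 * k
  odd = solve-∀
... | suc (suc _) | s≤s (s≤s ()) | _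

odd-1+2* : ∀ k → Odd (+ 1 + + 2 * k)
odd-1+2* k 2∣1+2k = 2≢1 (ℕ.∣1⇒≡1 (Signed.∣⇒∣ᵤ 2∣1))
  where
  2∣1 : + 2 Signed.∣ + 1
  2∣1 = Signed.∣m+n∣n⇒∣m (Signed.∣ᵤ⇒∣ 2∣1+2k) (Signed.∣m⇒∣m*n k Signed.∣-refl)
  2≢1 : ¬ 2 ≡ 1
  2≢1 ()

odd-* : ∀ x y → Odd x → Odd y → Odd (x * y)
odd-* x y odd-x odd-y 2∣xy =
  [ odd-x , odd-y ]′ (euclidsLemma ∣ x ∣ ∣ y ∣ (from-yes (prime? 2)) (subst (2 ℕ.∣_) (abs-* x y) 2∣xy))

odd-product : ∀ {c} a b d → c ≡ (+ 1 + + 2 * a) * (+ 1 + + 2 * b) * (+ 1 + + 2 * d) → Odd c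
odd-product a b d refl =
  odd-* ((+ 1 + + 2 * a) * (+ 1 + + 2 * b)) (+ 1 + + 2 * d)
    (odd-* (+ 1 + + 2 * a) (+ 1 + + 2 * b) (odd-1+2* a) (odd-1+2* b)) (odd-1+2* d)

consecutive-even : ∀ k → + 2 Signed.∣ k * (k + + 1)
consecutive-even k with even-or-odd k
... | j , inj₁ refl = Signed.divides (j * (+ 2 * j + + 1)) (even j)
  where
  even : ∀ j → + 2 * j * (+ 2 * j + + 1) ≡ j * (+ 2 * j + + 1) * + 2
  even = solve-∀
... | j , inj₂ refl = Signed.divides ((+ 1 + + 2 * j) * (j + + 1)) (odd j)
  where
  odd : ∀ j → (+ 1 + + 2 * j) * (+ 1 + + 2 * j + + 1) ≡ (+ 1 + + 2 * j) * (j + + 1) * + 2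
  odd = solve-∀

odd⊎16∣norm*[e-o]*[e+o] : ∀ e o s t →
  let c = norm (e + + 2 * s , o + + 2 * t) * (e - o) * (e + o) in Odd c ⊎ + 16 ∣ c
odd⊎16∣norm*[e-o]*[e+o] e o s t with even-or-odd e | even-or-odd o
... | k , inj₁ refl | m , inj₁ refl =
  inj₂ (Signed.∣⇒∣ᵤ (Signed.divides (((k + s) * (k + s) + (m + t) * (m + t)) * (k - m) * (k + m)) (expand k m s t)))
  where
  expand : ∀ k m s t →
    let x = + 2 * k + + 2 * s ; y = + 2 * m + + 2 * t in
    (x * x + y * y) * (+ 2 * k - + 2 * m) * (+ 2 * k + + 2 * m) ≡
    (((k + s) * (k + s) + (m + t) * (m + t)) * (k - m) * (k + m)) * + 16
  expand = solve-∀
... | k , inj₂ refl | m , inj₁ refl =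
  inj₁ (odd-product (+ 2 * ((k + s) + (k + s) * (k + s) + (m + t) * (m + t))) (k - m) (k + m) (expand k m s t))
  where
  expand : ∀ k m s t →
    let x = + 1 + + 2 * k + + 2 * s ; y = + 2 * m + + 2 * t in
    (x * x + y * y) * ((+ 1 + + 2 * k) - + 2 * m) * ((+ 1 + + 2 * k) + + 2 * m) ≡
    (+ 1 + + 2 * (+ 2 * ((k + s) + (k + s) * (k + s) + (m + t) * (m + t)))) *
      (+ 1 + + 2 * (k - m)) * (+ 1 + + 2 * (k + m))
  expand = solve-∀
... | k , inj₁ refl | m , inj₂ refl =
  inj₁ (odd-product (+ 2 * ((k + s) * (k + s) + (m + t) + (m + t) * (m + t))) (k - m - + 1) (k + m) (expand k m s t))
  where
  expand : ∀ k m s t →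
    let x = + 2 * k + + 2 * s ; y = + 1 + + 2 * m + + 2 * t in
    (x * x + y * y) * (+ 2 * k - (+ 1 + + 2 * m)) * (+ 2 * k + (+ 1 + + 2 * m)) ≡
    (+ 1 + + 2 * (+ 2 * ((k + s) * (k + s) + (m + t) + (m + t) * (m + t)))) *
      (+ 1 + + 2 * (k - m - + 1)) * (+ 1 + + 2 * (k + m))
  expand = solve-∀
... | k , inj₂ refl | m , inj₂ refl =
  inj₂ (Signed.∣⇒∣ᵤ (subst (+ 16 Signed.∣_) (sym (expand k m s t))
    (Signed.*-monoʳ-∣ (+ 8) (Signed.∣n⇒∣m*n w (Signed.∣m∣n⇒∣m-n (consecutive-even k) (consecutive-even m))))))
  where
  w : ℤ
  w = + 1 + + 2 * ((k + s) + (k + s) * (k + s) + (m + t) + (m + t) * (m + t))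
  -- x² + y² = 2w and e² − o² = 4 (k (k + 1) − m (m + 1)).
  expand : ∀ k m s t →
    let x = + 1 + + 2 * k + + 2 * s ; y = + 1 + + 2 * m + + 2 * t in
    (x * x + y * y) * ((+ 1 + + 2 * k) - (+ 1 + + 2 * m)) * ((+ 1 + + 2 * k) + (+ 1 + + 2 * m)) ≡
    + 8 * ((+ 1 + + 2 * ((k + s) + (k + s) * (k + s) + (m + t) + (m + t) * (m + t))) *
           (k * (k + + 1) - m * (m + + 1)))
  expand = solve-∀

lemma3p3 : (a : Vec ℤ 16) →
    ∃ λ (c : ℤ) → ((N a 4 ⊗ N a 8) ⊗ N a 16) ≡ const c × (Odd c ⊎ + 16 ∣ c)
lemma3p3 a with s , t , f[i] ← evalᵢ-i a =
  c (evalᵢ a i) , N-product a ,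
  subst (λ z → Odd (c z) ⊎ + 16 ∣ c z) (sym f[i]) (odd⊎16∣norm*[e-o]*[e+o] (evenSum a) (oddSum a) s t)
  where
  c : ℤ[i] → ℤ
  c z = norm z * (evenSum a - oddSum a) * (evenSum a + oddSum a)
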